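{- Let $\Pi=\{123,132\}$ and $n\ge3$. For every $\Phi\in\mathrm{ETP}[\Pi]$, the set of trees $\mathrm{cat}(\Phi)=\{\mathrm{cat}(\phi):\phi\in\Phi\}$ has the property that every triplet $(a|b,c)$ is consistent with at least one tree in it. Consequently $p(n)\le p_\Pi(n)$.
   Context: An ordering is a bijection $\phi:[n]\to[n]$. A ternary constraint is a triple $\mathbf x$ of distinct elements of $[n]$. $\mathrm{ord}(\phi,\mathbf x)$ is the word $abc\in S_3$ with $\phi(x_a)<\phi(x_b)<\phi(x_c)$. $\mathrm{ETP}[\Pi]$ is the set of sets $\Phi$ of orderings such that every constraint $\mathbf x$ has some $\phi\in\Phi$ with $\mathrm{ord}(\phi,\mathbf x)\in\Pi$. $p_\Pi(n)$ is the minimum size of a member of $\mathrm{ETP}[\Pi]$. $\mathrm{cat}(\phi)$ is the rooted caterpillar with leaves labelled by $[n]$ such that the $i$-th closest leaf to the root is labelled $\phi^{ -1}(i)$. A phylogenetic tree is a rooted binary tree with leaves labelled bijectively by $[n]$. It is consistent with the triplet $(a|b,c)$ ($a,b,c$ distinct) if the path from leaf $a$ to the root does not intersect the path between leaves $b$ and $c$. $p(n)$ is the minimum size of a set of phylogenetic trees on $[n]$ such that every triplet is consistent with some tree in the set. -}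

module Defs where

open import Data.Nat using (ℕ; zero; suc; _≤_)
open import Data.Fin using (Fin; _<_)
open import Data.Fin.Permutation using (Permutation′; _⟨$⟩ʳ_; _⟨$⟩ˡ_)
open import Data.List using (List; []; _∷_; _++_; length; map; allFin; tabulate)
open import Data.List.Relation.Unary.Any using (Any)
open import Data.List.Relation.Binary.Permutation.Propositional using (_↭_)
open import Data.Product using (_×_; Σ; ∃; ∃-syntax)
open import Data.Sum using (_⊎_)
open import Relation.Binary.PropositionalEquality using (_≡_; _≢_)
open import Relation.Nullary using (¬_)
open import Function using (_∘_)

Ordering : ℕ → Set
Ordering n = Permutation′ n

record Constraint (n : ℕ) : Set where
  constructor ⟨_,_,_⟩
  field
    x₁ x₂ x₃ : Fin n
    d₁₂ : x₁ ≢ x₂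
    d₁₃ : x₁ ≢ x₃
    d₂₃ : x₂ ≢ x₃

data S₃ : Set where
  w123 w132 w213 w231 w312 w321 : S₃

pick : ∀ {n} → Constraint n → S₃ → Fin n × Fin n × Fin n
pick c w123 = Constraint.x₁ c Data.Product., Constraint.x₂ c Data.Product., Constraint.x₃ c
pick c w132 = Constraint.x₁ c Data.Product., Constraint.x₃ c Data.Product., Constraint.x₂ c
pick c w213 = Constraint.x₂ c Data.Product., Constraint.x₁ c Data.Product., Constraint.x₃ c
pick c w231 = Constraint.x₂ c Data.Product., Constraint.x₃ c Data.Product., Constraint.x₁ c
pick c w312 = Constraint.x₃ c Data.Product., Constraint.x₁ c Data.Product., Constraint.x₂ c
pick c w321 = Constraint.x₃ c Data.Product., Constraint.x₂ c Data.Product., Constraint.x₁ c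

OrdIs : ∀ {n} → Ordering n → Constraint n → S₃ → Set
OrdIs φ x w with pick x w
... | (a Data.Product., b Data.Product., c) = (φ ⟨$⟩ʳ a) < (φ ⟨$⟩ʳ b) × (φ ⟨$⟩ʳ b) < (φ ⟨$⟩ʳ c)

Π₁₂₃₁₃₂ : S₃ → Set
Π₁₂₃₁₃₂ w = (w ≡ w123) ⊎ (w ≡ w132)

OrdIn : ∀ {n} → (S₃ → Set) → Ordering n → Constraint n → Set
OrdIn Π φ x = ∃[ w ] (Π w × OrdIs φ x w)

InETP : ∀ {n} → (S₃ → Set) → List (Ordering n) → Set
InETP Π Φ = ∀ x → Any (λ φ → OrdIn Π φ x) Φ

data Tree (n : ℕ) : Set where
  leaf : Fin n → Tree n
  node : Tree n → Tree n → Tree n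

leaves : ∀ {n} → Tree n → List (Fin n)
leaves (leaf a)   = a ∷ []
leaves (node l r) = leaves l ++ leaves r

IsPhylo : ∀ {n} → Tree n → Set
IsPhylo {n} t = leaves t ↭ allFin n

-- Vertices of a tree are addressed by paths from the root.
data Dir : Set where
  L R : Dir

Address : Set
Address = List Dir

data Pos {n : ℕ} : Tree n → Fin n → Address → Set where
  here : ∀ {a} → Pos (leaf a) a []
  inL  : ∀ {l r a p} → Pos l a p → Pos (node l r) a (L ∷ p)
  inR  : ∀ {l r a p} → Pos r a p → Pos (node l r) a (R ∷ p)

data _≼_ : Address → Address → Set where
  []≼ : ∀ {v} → [] ≼ v
  ∷≼  : ∀ {d u v} → u ≼ v → (d ∷ u) ≼ (d ∷ v)

OnRootPath : ∀ {n} → Tree n → Fin n → Address → Set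
OnRootPath t a v = ∃[ p ] (Pos t a p × v ≼ p)

-- v lies on the path between leaves b and c: v is an ancestor of b or of c,
-- and a descendant of every common ancestor of b and c (i.e. of their lca).
OnPath : ∀ {n} → Tree n → Fin n → Fin n → Address → Set
OnPath t b c v = ∃[ p ] ∃[ q ] (Pos t b p × Pos t c q ×
                   ((v ≼ p) ⊎ (v ≼ q)) × (∀ w → w ≼ p → w ≼ q → w ≼ v))

Consistent : ∀ {n} → Tree n → Fin n → Fin n → Fin n → Set
Consistent t a b c = ¬ (∃[ v ] (OnRootPath t a v × OnPath t b c v))

CoversTriplets : ∀ {n} → List (Tree n) → Set
CoversTriplets T = ∀ a b c → a ≢ b → a ≢ c → b ≢ c → Any (λ t → Consistent t a b c) T

catList : ∀ {n} → Fin n → List (Fin n) → Tree n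
catList x []       = leaf x
catList x (y ∷ ys) = node (leaf x) (catList y ys)

cat : ∀ {m} → Ordering (suc m) → Tree (suc m)
cat {m} φ = catList (φ ⟨$⟩ˡ Data.Fin.zero) (tabulate {n = m} (λ i → φ ⟨$⟩ˡ Data.Fin.suc i))

IsMin : (ℕ → Set) → ℕ → Set
IsMin P k = P k × (∀ j → P j → k ≤ j)

ETPSize : (S₃ → Set) → ℕ → ℕ → Set
ETPSize Π n k = ∃[ Φ ] (length {A = Ordering n} Φ ≡ k × InETP Π Φ)

TreeCoverSize : ℕ → ℕ → Set
TreeCoverSize n k = ∃[ T ] (length {A = Tree n} T ≡ k × ((∀ t → Any (t ≡_) T → IsPhylo t) × CoversTriplets T))

module Submission where

-- A caterpillar is a spine of right children; its i-th leaf hangs off the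
-- spine vertex Rⁱ.  Write `spine k` for the address Rᵏ.  The proof has
-- three parts.
--   * Separation: in any tree, a vertex u that is an ancestor of b and c
--     but not of a forces consistency with (a | b, c), since every vertex
--     of the b–c path lies below lca(b,c), hence below u.
--   * Depth: in cat φ the leaf a lies below spine (φ a) but not below
--     spine (1 + φ a).  So if φ a < φ b and φ a < φ c, then u = spine (1 + φ a)
--     separates a from b and c.  An ordering with ord(φ, abc) ∈ {123, 132}
--     puts a first, so cat(Φ) covers every triplet that Φ covers.
--   * Phylogeneticity: the leaves of cat φ are the list of φ⁻¹(0..n-1),
--     a duplicate-free list of all of [n], hence a permutation of allFin n.
-- The bound p ≤ p_Π follows by applying the minimality of p to cat(Φ) for a
-- minimal Φ ∈ ETP[Π].

open import Defs
open import Data.Nat using (ℕ; suc; _≤_)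
open import Data.List using (List; map)
open import Data.Product using (_×_)

open import Data.Nat using (zero; z≤n; s≤s)
open import Data.Nat.Properties using (<-trans)
open import Data.Fin as Fin using (Fin; toℕ)
open import Data.Fin.Permutation using (_⟨$⟩ʳ_; _⟨$⟩ˡ_; inverseˡ; inverseʳ)
open import Data.List using ([]; _∷_; tabulate; allFin; length)
open import Data.List.Properties using (length-map)
open import Data.List.Relation.Unary.Any using (Any; here; there)
import Data.List.Relation.Unary.Any as Any
open import Data.List.Relation.Unary.Any.Properties using (map⁺)
open import Data.List.Relation.Unary.Unique.Propositional.Properties using (tabulate⁺; allFin⁺)
open import Data.List.Membership.Propositional.Properties using (∈-tabulate⁺; ∈-allFin)
open import Data.List.Membership.Propositional.Properties.WithK using (unique∧set⇒bag)
open import Data.List.Relation.Binary.Permutation.Propositional using (_↭_)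
open import Data.List.Relation.Binary.BagAndSetEquality using (∼bag⇒↭)
open import Data.Product using (∃; _,_; proj₁; proj₂)
open import Data.Sum using (inj₁; inj₂)
open import Function using (_∘_)
open import Function.Bundles using (mk⇔)
open import Relation.Binary.PropositionalEquality using (_≡_; refl; sym; trans; cong; subst)
open import Relation.Nullary using (¬_)

≼-trans : ∀ {u v w} → u ≼ v → v ≼ w → u ≼ w
≼-trans []≼     _       = []≼
≼-trans (∷≼ p) (∷≼ q) = ∷≼ (≼-trans p q)

separated⇒consistent : ∀ {n} (t : Tree n) (a b c : Fin n) (u : Address) →
  (∀ {p} → Pos t a p → ¬ (u ≼ p)) →
  (∀ {q} → Pos t b q → u ≼ q) →
  (∀ {q} → Pos t c q → u ≼ q) →
  Consistent t a b c
separated⇒consistent t a b c u u⋠a u≼b u≼c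
  (v , (pa , posa , v≼pa) , (pb , pc , posb , posc , _ , belowLca)) =
  u⋠a posa (≼-trans u≼v v≼pa)
  where
  u≼v : u ≼ v
  u≼v = belowLca u (u≼b posb) (u≼c posc)

spine : ℕ → Address
spine zero    = []
spine (suc k) = R ∷ spine k

spine-mono : ∀ {i j} → i ≤ j → spine i ≼ spine j
spine-mono z≤n     = []≼
spine-mono (s≤s p) = ∷≼ (spine-mono p)

HangsAt : ℕ → Address → Set
HangsAt k p = spine k ≼ p × ¬ (spine (suc k) ≼ p)

caterpillar : ∀ {m n} → (Fin (suc m) → Fin n) → Tree n
caterpillar {m} g = catList (g Fin.zero) (tabulate {n = m} (g ∘ Fin.suc))

caterpillar-pos : ∀ {m n} (g : Fin (suc m) → Fin n) {a p} →
  Pos (caterpillar g) a p → ∃ λ i → g i ≡ a × HangsAt (toℕ i) p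
caterpillar-pos {zero}  g here       = Fin.zero , refl , []≼ , λ ()
caterpillar-pos {suc m} g (inL here) = Fin.zero , refl , []≼ , λ ()
caterpillar-pos {suc m} g (inR pos) with caterpillar-pos (g ∘ Fin.suc) pos
... | i , gi≡a , spine≼p , spine⋠p =
  Fin.suc i , gi≡a , ∷≼ spine≼p , λ { (∷≼ r) → spine⋠p r }

cat-depth : ∀ {m} (φ : Ordering (suc m)) {a p} →
  Pos (cat φ) a p → HangsAt (toℕ (φ ⟨$⟩ʳ a)) p
cat-depth φ pos with caterpillar-pos (φ ⟨$⟩ˡ_) pos
... | i , refl , hangs = subst (λ j → HangsAt (toℕ j) _) (sym (inverseʳ φ)) hangs

-- If φ puts a before both b and c, then cat φ is consistent with (a | b, c):
-- the spine vertex just below a's attachment point separates a from b, c.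
cat-consistent : ∀ {m} (φ : Ordering (suc m)) (a b c : Fin (suc m)) →
  (φ ⟨$⟩ʳ a) Fin.< (φ ⟨$⟩ʳ b) → (φ ⟨$⟩ʳ a) Fin.< (φ ⟨$⟩ʳ c) →
  Consistent (cat φ) a b c
cat-consistent φ a b c a<b a<c =
  separated⇒consistent (cat φ) a b c (spine (suc (toℕ (φ ⟨$⟩ʳ a))))
    (λ pos → proj₂ (cat-depth φ pos))
    (λ pos → ≼-trans (spine-mono a<b) (proj₁ (cat-depth φ pos)))
    (λ pos → ≼-trans (spine-mono a<c) (proj₁ (cat-depth φ pos)))

-- Both words of Π = {123, 132} put x₁ first.
Π-consistent : ∀ {m} (φ : Ordering (suc m)) (x : Constraint (suc m)) →
  OrdIn Π₁₂₃₁₃₂ φ x →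
  Consistent (cat φ) (Constraint.x₁ x) (Constraint.x₂ x) (Constraint.x₃ x)
Π-consistent φ x (_ , inj₁ refl , 1<2 , 2<3) = cat-consistent φ _ _ _ 1<2 (<-trans 1<2 2<3)
Π-consistent φ x (_ , inj₂ refl , 1<3 , 3<2) = cat-consistent φ _ _ _ (<-trans 1<3 3<2) 1<3

cat-covers : ∀ {m} (Φ : List (Ordering (suc m))) →
  InETP Π₁₂₃₁₃₂ Φ → CoversTriplets (map cat Φ)
cat-covers Φ etp a b c a≢b a≢c b≢c =
  map⁺ (Any.map (λ {φ} → Π-consistent φ x) (etp x))
  where x = ⟨ a , b , c ⟩ a≢b a≢c b≢c

leaves-catList : ∀ {n} (x : Fin n) (xs : List (Fin n)) → leaves (catList x xs) ≡ x ∷ xs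
leaves-catList x []       = refl
leaves-catList x (y ∷ ys) = cong (x ∷_) (leaves-catList y ys)

-- Listing the values of a bijection of Fin n gives a permutation of allFin n:
-- both lists are duplicate-free and contain every element.
tabulate-bijection-↭ : ∀ {n} (g : Fin n → Fin n) →
  (∀ {i j} → g i ≡ g j → i ≡ j) → (∀ y → ∃ λ i → g i ≡ y) →
  tabulate g ↭ allFin n
tabulate-bijection-↭ {n} g injective surjective =
  ∼bag⇒↭ (unique∧set⇒bag (tabulate⁺ injective) (allFin⁺ n)
            (λ {y} → mk⇔ (λ _ → ∈-allFin y) (λ _ → hit y)))
  where
  hit : ∀ y → Any (y ≡_) (tabulate g)
  hit y with surjective y
  ... | i , refl = ∈-tabulate⁺ i

cat-phylo : ∀ {m} (φ : Ordering (suc m)) → IsPhylo (cat φ)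
cat-phylo φ =
  subst (_↭ allFin _) (sym (leaves-catList _ _))
    (tabulate-bijection-↭ (φ ⟨$⟩ˡ_) injective (λ y → φ ⟨$⟩ʳ y , inverseˡ φ))
  where
  injective : ∀ {i j} → φ ⟨$⟩ˡ i ≡ φ ⟨$⟩ˡ j → i ≡ j
  injective {i} {j} e = trans (sym (inverseʳ φ)) (trans (cong (φ ⟨$⟩ʳ_) e) (inverseʳ φ))

cats-phylo : ∀ {m} (Φ : List (Ordering (suc m))) t → Any (t ≡_) (map cat Φ) → IsPhylo t
cats-phylo (φ ∷ Φ) t (here refl) = cat-phylo φ
cats-phylo (φ ∷ Φ) t (there t∈)  = cats-phylo Φ t t∈

proposition5p4 : (m : ℕ) → 3 ≤ suc m →
    ((Φ : List (Ordering (suc m))) → InETP Π₁₂₃₁₃₂ Φ → CoversTriplets (map cat Φ))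
    × ((p pΠ : ℕ) → IsMin (TreeCoverSize (suc m)) p → IsMin (ETPSize Π₁₂₃₁₃₂ (suc m)) pΠ → p ≤ pΠ)
proposition5p4 m _ = cat-covers , bound
  where
  -- cat(Φ) is a tree cover of size |Φ|, so p ≤ |Φ| = p_Π.
  bound : (p pΠ : ℕ) → IsMin (TreeCoverSize (suc m)) p →
          IsMin (ETPSize Π₁₂₃₁₃₂ (suc m)) pΠ → p ≤ pΠ
  bound p _ (_ , p-least) ((Φ , refl , etp) , _) =
    p-least (length Φ) (map cat Φ , length-map cat Φ , cats-phylo Φ , cat-covers Φ etp)
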